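{- Let $n\geq 3$ and let $K_{1,n}$ be the star with center $r$, leaves $v_0,\dots,v_{n-1}$, and edges $i=rv_i$ for $0\leq i<n$ (so $E=\{0,\dots,n-1\}$). Let $S=\{\{v_i,v_{(i+1)\bmod n}\}:0\leq i<n\}$. Then $\mathrm{MultC}(K_{1,n},S)$ is completely described by the inequalities $x_e\geq 0$ for all $e\in E$; $x_i+x_{(i+1)\bmod n}\geq 1$ for $0\leq i<n$; and $\sum_{e\in E}x_e\geq\lceil n/2\rceil$, where the last inequality can be omitted if and only if $n$ is even.
   Context: Given a graph $G=(V,E)$ and $S\subseteq\binom{V}{2}$, an ($S$-)multicut is a set $\delta\subseteq E$ such that for every $\{s,t\}\in S$ the nodes $s$ and $t$ lie in different components of $G-\delta$. For $F\subseteq E$, $x^F\in\mathbb{R}^E$ is its incidence vector. The multicut dominant is $\mathrm{MultC}(G,S)=\mathrm{conv}\{x^\delta:\delta\text{ an } S\text{ -multicut}\}+\mathbb{R}^E_{\geq 0}$.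
   Formalization: The multicut dominant and both inequality systems are taken over ℚ^E instead of ℝ^E, and the coefficients of the convex combinations of multicut incidence vectors are rational. -}

module Defs where

open import Data.Nat as ℕ using (ℕ; zero; suc; ⌈_/2⌉)
open import Data.Nat.DivMod using (_mod_)
open import Data.Fin as F using (Fin; toℕ)
open import Data.Bool using (Bool; true; false)
open import Data.Product using (_×_; _,_; proj₁; proj₂; Σ)
open import Data.List as L using (List; []; _∷_)
open import Data.List.Relation.Unary.All using (All)
open import Data.Integer using (+_)
open import Data.Rational using (ℚ; 0ℚ; 1ℚ; _+_; _*_; _≤_; _/_)
open import Relation.Binary.PropositionalEquality using (_≡_)
open import Relation.Nullary using (¬_)
open import Function.Bundles using (_⇔_)

record Graph : Set₁ where
  field
    V    : Set
    E    : Set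
    ends : E → V × V
open Graph public

EdgeSet : Graph → Set
EdgeSet G = E G → Bool

-- u and w lie in the same component of G - δ.
data Reach (G : Graph) (δ : EdgeSet G) : V G → V G → Set where
  here  : ∀ {u} → Reach G δ u u
  fwd   : ∀ {u w} (e : E G) → δ e ≡ false → proj₁ (ends G e) ≡ u →
          Reach G δ (proj₂ (ends G e)) w → Reach G δ u w
  bwd   : ∀ {u w} (e : E G) → δ e ≡ false → proj₂ (ends G e) ≡ u →
          Reach G δ (proj₁ (ends G e)) w → Reach G δ u w

IsMulticut : (G : Graph) → (S : List (V G × V G)) → EdgeSet G → Set
IsMulticut G S δ = All (λ st → ¬ Reach G δ (proj₁ st) (proj₂ st)) S

ℕ→ℚ : ℕ → ℚ
ℕ→ℚ k = + k / 1

χ : Bool → ℚ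
χ true  = 1ℚ
χ false = 0ℚ

Point : Graph → Set
Point G = E G → ℚ

sumL : {A : Set} → (A → ℚ) → List A → ℚ
sumL f []       = 0ℚ
sumL f (a ∷ as) = f a + sumL f as

-- Multicut dominant: x ≥ Σ_k λ_k x^{δ_k} for a finite convex combination
-- of incidence vectors of S-multicuts (conv + nonnegative orthant).
InMultC : (G : Graph) → (S : List (V G × V G)) → Point G → Set
InMultC G S x =
  Σ (List (ℚ × EdgeSet G)) λ comb →
    All (λ p → (0ℚ ≤ proj₁ p) × IsMulticut G S (proj₂ p)) comb ×
    (sumL proj₁ comb ≡ 1ℚ) ×
    (∀ e → sumL (λ p → proj₁ p * χ (proj₂ p e)) comb ≤ x e)

-- The star K_{1,n}: vertex 'zero' is the centre r,
-- vertex 'suc i' is the leaf v_i; edge i joins r and v_i.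
Star : ℕ → Graph
Star n = record { V = Fin (suc n) ; E = Fin n ; ends = λ i → (F.zero , F.suc i) }

next : {n : ℕ} → Fin n → Fin n
next {suc m} i = suc (toℕ i) mod suc m

allFinL : (n : ℕ) → List (Fin n)
allFinL zero    = []
allFinL (suc n) = F.zero ∷ L.map F.suc (allFinL n)

cycleTerminals : (n : ℕ) → List (Fin (suc n) × Fin (suc n))
cycleTerminals n = L.map (λ i → (F.suc i , F.suc (next i))) (allFinL n)

Nonneg : (n : ℕ) → (Fin n → ℚ) → Set
Nonneg n x = ∀ e → 0ℚ ≤ x e

EdgeIneqs : (n : ℕ) → (Fin n → ℚ) → Set
EdgeIneqs n x = ∀ i → 1ℚ ≤ x i + x (next i)

SumIneq : (n : ℕ) → (Fin n → ℚ) → Set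
SumIneq n x = ℕ→ℚ ⌈ n /2⌉ ≤ sumL x (allFinL n)

module Submission where

-- A multicut of the star separates every pair of consecutive leaves, i.e. it is a set of edges meeting
-- every pair {i, i+1}: a vertex cover of the n-cycle, which has at least ⌈n/2⌉ elements. Averaging
-- gives the three families of inequalities. Conversely, scale a solution x by a common denominator D
-- to naturals Xᵢ = D·xᵢ with Xᵢ + Xᵢ₊₁ ≥ D and ∑ X ≥ ⌈n/2⌉·D. Arcs of lengths Xᵢ, laid around a
-- circle of circumference D so that consecutive arcs together cover it, give one cover of the cycle
-- per point of the circle, using edge i at most Xᵢ times; x dominates their average. For even n the
-- edge inequalities already sum to ∑ x ≥ n/2, while for odd n the point x ≡ ½ satisfies them but
-- violates the sum inequality.

module CyclicCovers where

  open import Data.Nat.Base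
  open import Data.Nat.Properties
  open import Data.Nat.DivMod
  open import Data.Bool.Base using (Bool; true; false)
  open import Data.Product.Base using (Σ; _×_; _,_; proj₁; proj₂)
  open import Data.Sum.Base using (_⊎_; inj₁; inj₂)
  open import Function.Base using (_∘_)
  open import Relation.Binary.PropositionalEquality
  open import Relation.Nullary.Decidable using (Dec; does; yes; no; dec-true)
  open import Relation.Nullary.Negation using (contradiction)
  open import Algebra.Properties.CommutativeSemigroup +-commutativeSemigroup using (interchange)

  ∑< : ℕ → (ℕ → ℕ) → ℕ
  ∑< zero    f = 0
  ∑< (suc n) f = f 0 + ∑< n (f ∘ suc)

  syntax ∑< n (λ j → e) = ∑[ j < n ] e

  ∑<-cong : ∀ n {f g : ℕ → ℕ} → (∀ j → j < n → f j ≡ g j) → ∑< n f ≡ ∑< n g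
  ∑<-cong zero    f≡g = refl
  ∑<-cong (suc n) f≡g = cong₂ _+_ (f≡g 0 z<s) (∑<-cong n (λ j j<n → f≡g (suc j) (s<s j<n)))

  ∑<-mono : ∀ n {f g : ℕ → ℕ} → (∀ j → j < n → f j ≤ g j) → ∑< n f ≤ ∑< n g
  ∑<-mono zero    f≤g = z≤n
  ∑<-mono (suc n) f≤g = +-mono-≤ (f≤g 0 z<s) (∑<-mono n (λ j j<n → f≤g (suc j) (s<s j<n)))

  ∑<-const : ∀ n c → ∑[ _ < n ] c ≡ n * c
  ∑<-const zero    c = refl
  ∑<-const (suc n) c = cong (c +_) (∑<-const n c)

  ∑<-distrib-+ : ∀ n (f g : ℕ → ℕ) → ∑[ j < n ] (f j + g j) ≡ ∑< n f + ∑< n g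
  ∑<-distrib-+ zero    f g = refl
  ∑<-distrib-+ (suc n) f g =
    trans (cong (f 0 + g 0 +_) (∑<-distrib-+ n (f ∘ suc) (g ∘ suc))) (interchange (f 0) (g 0) (∑< n (f ∘ suc)) (∑< n (g ∘ suc)))

  ∑<-last : ∀ n (f : ℕ → ℕ) → ∑< (suc n) f ≡ ∑< n f + f n
  ∑<-last zero    f = +-comm (f 0) 0
  ∑<-last (suc n) f = trans (cong (f 0 +_) (∑<-last n (f ∘ suc))) (sym (+-assoc (f 0) _ _))

  ∑<-shift : ∀ n (f : ℕ → ℕ) → f n ≡ f 0 → ∑< n (f ∘ suc) ≡ ∑< n f
  ∑<-shift n f fn≡f0 = +-cancelʳ-≡ (f 0) _ _ (begin
    ∑< n (f ∘ suc) + f 0  ≡⟨ +-comm _ (f 0) ⟩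
    ∑< (suc n) f          ≡⟨ ∑<-last n f ⟩
    ∑< n f + f n          ≡⟨ cong (∑< n f +_) fn≡f0 ⟩
    ∑< n f + f 0          ∎)
    where open ≡-Reasoning

  succMod : (n : ℕ) .{{_ : NonZero n}} → ℕ → ℕ
  succMod n j = suc j % n

  module _ {n : ℕ} .{{_ : NonZero n}} where

    succMod-< : ∀ {j} → suc j < n → succMod n j ≡ suc j
    succMod-< = m<n⇒m%n≡m

    succMod-last : ∀ {j} → suc j ≡ n → succMod n j ≡ 0
    succMod-last refl = n%n≡0 n

    ∑<-rotate : ∀ (f : ℕ → ℕ) → ∑< n (f ∘ succMod n) ≡ ∑< n f
    ∑<-rotate f = begin
      ∑< n (f ∘ succMod n)      ≡⟨ ∑<-shift n (λ j → f (j % n)) (cong f (trans (n%n≡0 n) (sym 0%n≡0))) ⟩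
      ∑[ j < n ] f (j % n)      ≡⟨ ∑<-cong n (λ j j<n → cong f (m<n⇒m%n≡m j<n)) ⟩
      ∑< n f                    ∎
      where
      open ≡-Reasoning
      0%n≡0 : 0 % n ≡ 0
      0%n≡0 = m<n⇒m%n≡m (>-nonZero⁻¹ n)

    ∑<-pair : ∀ (f : ℕ → ℕ) → ∑[ j < n ] (f j + f (succMod n j)) ≡ ∑< n f + ∑< n f
    ∑<-pair f = trans (∑<-distrib-+ n f (f ∘ succMod n)) (cong (∑< n f +_) (∑<-rotate f))

  𝟙 : Bool → ℕ
  𝟙 true  = 1
  𝟙 false = 0

  ⌈n/2⌉-least : ∀ {k s} → k ≤ s + s → ⌈ k /2⌉ ≤ s
  ⌈n/2⌉-least {k} {s} k≤2s = subst (⌈ k /2⌉ ≤_) (sym (n≡⌈n+n/2⌉ s)) (⌈n/2⌉-mono k≤2s)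

  +-self-cancel-≤ : ∀ {a b} → a + a ≤ b + b → a ≤ b
  +-self-cancel-≤ {a} {b} 2a≤2b = subst₂ _≤_ (sym (n≡⌊n+n/2⌋ a)) (sym (n≡⌊n+n/2⌋ b)) (⌊n/2⌋-mono 2a≤2b)

  ∑<-interpolate : ∀ n (L U : ℕ → ℕ) T → (∀ j → j < n → L j ≤ U j) →
                   ∑< n L ≤ T → T ≤ ∑< n U →
                   Σ (ℕ → ℕ) λ d → (∀ j → j < n → L j ≤ d j × d j ≤ U j) × ∑< n d ≡ T
  ∑<-interpolate zero    L U T L≤U ΣL≤T T≤ΣU = (λ _ → 0) , (λ _ ()) , sym (n≤0⇒n≡0 T≤ΣU)
  ∑<-interpolate (suc n) L U T L≤U ΣL≤T T≤ΣU = d , d-bounds , ∑d≡T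
    where
    restL = ∑< n (L ∘ suc)
    -- the first value is as large as possible, the rest is distributed recursively
    d₀ = U 0 ⊓ (T ∸ restL)
    restL≤T : restL ≤ T
    restL≤T = m+n≤o⇒n≤o (L 0) ΣL≤T
    d₀≤T : d₀ ≤ T
    d₀≤T = ≤-trans (m⊓n≤n (U 0) _) (m∸n≤m T restL)
    restL≤T∸d₀ : restL ≤ T ∸ d₀
    restL≤T∸d₀ = m+n≤o⇒m≤o∸n restL (subst (_≤ T) (+-comm d₀ restL) (m≤o∸n⇒m+n≤o d₀ restL≤T (m⊓n≤n (U 0) _)))
    T∸d₀≤restU : T ∸ d₀ ≤ ∑< n (U ∘ suc)
    T∸d₀≤restU with U 0 ≤? T ∸ restL
    ... | yes U₀≤ rewrite m≤n⇒m⊓n≡m U₀≤ = m≤n+o⇒m∸n≤o T (U 0) T≤ΣU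
    ... | no  U₀≰ rewrite m≥n⇒m⊓n≡n (<⇒≤ (≰⇒> U₀≰)) | m∸[m∸n]≡n restL≤T =
          ∑<-mono n (λ j j<n → L≤U (suc j) (s<s j<n))
    rest = ∑<-interpolate n (L ∘ suc) (U ∘ suc) (T ∸ d₀) (λ j j<n → L≤U (suc j) (s<s j<n)) restL≤T∸d₀ T∸d₀≤restU
    d : ℕ → ℕ
    d zero    = d₀
    d (suc j) = proj₁ rest j
    d-bounds : ∀ j → j < suc n → L j ≤ d j × d j ≤ U j
    d-bounds zero    _         = ⊓-glb (L≤U 0 z<s) (m+n≤o⇒m≤o∸n (L 0) ΣL≤T) , m⊓n≤m (U 0) _
    d-bounds (suc j) (s≤s j<n) = proj₁ (proj₂ rest) j j<n
    ∑d≡T : d₀ + ∑< n (proj₁ rest) ≡ T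
    ∑d≡T = trans (cong (d₀ +_) (proj₂ (proj₂ rest))) (m+[n∸m]≡n d₀≤T)

  count-< : ∀ N Y → ∑[ k < N ] 𝟙 (does (k <? Y)) ≡ Y ⊓ N
  count-< zero    Y = sym (⊓-zeroʳ Y)
  count-< (suc N) Y = begin
    ∑[ k < suc N ] 𝟙 (does (k <? Y))                   ≡⟨ ∑<-last N _ ⟩
    ∑[ k < N ] 𝟙 (does (k <? Y)) + 𝟙 (does (N <? Y))  ≡⟨ cong (_+ 𝟙 (does (N <? Y))) (count-< N Y) ⟩
    Y ⊓ N + 𝟙 (does (N <? Y))                          ≡⟨ step (N <? Y) ⟩
    Y ⊓ suc N                                          ∎
    where
    open ≡-Reasoning
    step : (N<?Y : Dec (N < Y)) → Y ⊓ N + 𝟙 (does N<?Y) ≡ Y ⊓ suc N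
    step (yes N<Y) rewrite m≥n⇒m⊓n≡n (<⇒≤ N<Y) | m≥n⇒m⊓n≡n N<Y = +-comm N 1
    step (no  N≮Y) rewrite m≤n⇒m⊓n≡m (≮⇒≥ N≮Y) | m≤n⇒m⊓n≡m (m≤n⇒m≤1+n (≮⇒≥ N≮Y)) = +-identityʳ Y

  count-window : ∀ D .{{_ : NonZero D}} c Y → ∑[ k < D ] 𝟙 (does ((k + c) % D <? Y)) ≡ Y ⊓ D
  count-window D zero Y = trans
    (∑<-cong D λ k k<D → cong (λ i → 𝟙 (does (i <? Y))) (trans (%-congˡ (+-identityʳ k)) (m<n⇒m%n≡m k<D)))
    (count-< D Y)
  count-window D (suc c) Y = begin
    ∑[ k < D ] 𝟙 (does ((k + suc c) % D <? Y))  ≡⟨ ∑<-cong D (λ k _ → cong (λ i → 𝟙 (does (i % D <? Y))) (+-suc k c)) ⟩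
    ∑< D (window ∘ suc)                         ≡⟨ ∑<-shift D window periodic ⟩
    ∑< D window                                 ≡⟨ count-window D c Y ⟩
    Y ⊓ D                                       ∎
    where
    open ≡-Reasoning
    window : ℕ → ℕ
    window k = 𝟙 (does ((k + c) % D <? Y))
    periodic : window D ≡ window 0
    periodic = cong (λ i → 𝟙 (does (i <? Y))) (trans (%-congˡ (+-comm D c)) ([m+n]%n≡m%n c D))

  [m%d+n]%d≡[m+n]%d : ∀ m n d .{{_ : NonZero d}} → (m % d + n) % d ≡ (m + n) % d
  [m%d+n]%d≡[m+n]%d m n d = begin
    (m % d + n) % d          ≡⟨ %-distribˡ-+ (m % d) n d ⟩
    (m % d % d + n % d) % d  ≡⟨ cong (λ i → (i + n % d) % d) (m%n%n≡m%n m d) ⟩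
    (m % d + n % d) % d      ≡⟨ %-distribˡ-+ m n d ⟨
    (m + n) % d              ∎
    where open ≡-Reasoning

  [a+d]%D<d : ∀ {D} .{{_ : NonZero D}} {a d} → a < D → D ≤ a + d → (a + d) % D < d
  [a+d]%D<d {D} {a} {d} a<D D≤a+d = begin-strict
    (a + d) % D      ≡⟨ m≤n⇒[n∸m]%m≡n%m D≤a+d ⟨
    (a + d ∸ D) % D  ≤⟨ m%n≤m (a + d ∸ D) D ⟩
    a + d ∸ D        <⟨ ∸-monoˡ-< (+-monoˡ-< d a<D) D≤a+d ⟩
    D + d ∸ D        ≡⟨ m+n∸m≡n D d ⟩
    d                ∎
    where open ≤-Reasoning

  n≤⌈n/2⌉+⌈n/2⌉ : ∀ n → n ≤ ⌈ n /2⌉ + ⌈ n /2⌉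
  n≤⌈n/2⌉+⌈n/2⌉ n = subst (_≤ ⌈ n /2⌉ + ⌈ n /2⌉) (⌊n/2⌋+⌈n/2⌉≡n n) (+-monoˡ-≤ ⌈ n /2⌉ (⌊n/2⌋≤⌈n/2⌉ n))

  ⌈n/2⌉+⌈n/2⌉≡n-even : ∀ n → n % 2 ≡ 0 → ⌈ n /2⌉ + ⌈ n /2⌉ ≡ n
  ⌈n/2⌉+⌈n/2⌉≡n-even zero          _    = refl
  ⌈n/2⌉+⌈n/2⌉≡n-even (suc (suc n)) even = cong suc (trans (+-suc ⌈ n /2⌉ ⌈ n /2⌉) (cong suc (⌈n/2⌉+⌈n/2⌉≡n-even n even)))

  n<⌈n/2⌉+⌈n/2⌉-odd : ∀ n → n % 2 ≢ 0 → n < ⌈ n /2⌉ + ⌈ n /2⌉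
  n<⌈n/2⌉+⌈n/2⌉-odd zero          odd = contradiction refl odd
  n<⌈n/2⌉+⌈n/2⌉-odd (suc zero)    _   = s≤s (s≤s z≤n)
  n<⌈n/2⌉+⌈n/2⌉-odd (suc (suc n)) odd = s<s (subst (suc n <_) (sym (+-suc ⌈ n /2⌉ ⌈ n /2⌉)) (s<s (n<⌈n/2⌉+⌈n/2⌉-odd n odd)))

  CoversCycleℕ : (n : ℕ) .{{_ : NonZero n}} → (ℕ → Bool) → Set
  CoversCycleℕ n δ = ∀ j → j < n → δ j ≡ true ⊎ δ (succMod n j) ≡ true

  ∑<-pair-lower-bound : ∀ {n} .{{_ : NonZero n}} {c} (f : ℕ → ℕ) → (∀ j → j < n → c ≤ f j + f (succMod n j)) →
                        n * c ≤ ∑< n f + ∑< n f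
  ∑<-pair-lower-bound {n} {c} f c≤pair = begin
    n * c                                ≡⟨ ∑<-const n c ⟨
    ∑[ _ < n ] c                         ≤⟨ ∑<-mono n c≤pair ⟩
    ∑[ j < n ] (f j + f (succMod n j))   ≡⟨ ∑<-pair f ⟩
    ∑< n f + ∑< n f                      ∎
    where open ≤-Reasoning

  ⌈n/2⌉≤cover : ∀ {n} .{{_ : NonZero n}} {δ} → CoversCycleℕ n δ → ⌈ n /2⌉ ≤ ∑< n (𝟙 ∘ δ)
  ⌈n/2⌉≤cover {n} {δ} covers = ⌈n/2⌉-least (subst (_≤ ∑< n (𝟙 ∘ δ) + ∑< n (𝟙 ∘ δ)) (*-identityʳ n)
    (∑<-pair-lower-bound (𝟙 ∘ δ) (λ j j<n → one-of (covers j j<n))))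
    where
    one-of : ∀ {a b} → a ≡ true ⊎ b ≡ true → 1 ≤ 𝟙 a + 𝟙 b
    one-of {b = b} (inj₁ refl) = s≤s z≤n
    one-of {a = a} (inj₂ refl) = subst (1 ≤_) (+-comm 1 (𝟙 a)) (s≤s z≤n)

  even⇒⌈n/2⌉*c≤∑< : ∀ {n} .{{_ : NonZero n}} {c} (f : ℕ → ℕ) → n % 2 ≡ 0 →
                    (∀ j → j < n → c ≤ f j + f (succMod n j)) → ⌈ n /2⌉ * c ≤ ∑< n f
  even⇒⌈n/2⌉*c≤∑< {n} {c} f even c≤pair = +-self-cancel-≤ (begin
    ⌈ n /2⌉ * c + ⌈ n /2⌉ * c    ≡⟨ *-distribʳ-+ c ⌈ n /2⌉ ⌈ n /2⌉ ⟨
    (⌈ n /2⌉ + ⌈ n /2⌉) * c      ≡⟨ cong (_* c) (⌈n/2⌉+⌈n/2⌉≡n-even n even) ⟩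
    n * c                        ≤⟨ ∑<-pair-lower-bound f c≤pair ⟩
    ∑< n f + ∑< n f              ∎)
    where open ≤-Reasoning

  -- Edge j receives the arc [−pⱼ, −pⱼ + Xⱼ) of the circle ℤ/D, where the offsets pⱼ = d₀ + ⋯ + dⱼ₋₁
  -- advance by dⱼ ∈ [D − Xⱼ, Xⱼ₊₁]; consecutive arcs therefore overlap to cover the circle, and
  -- the total advance ⌈n/2⌉·D ≡ 0 closes the cycle.
  arcCovers : ∀ n D .{{_ : NonZero n}} .{{_ : NonZero D}} (X : ℕ → ℕ) →
              (∀ j → j < n → D ≤ X j + X (succMod n j)) → ⌈ n /2⌉ * D ≤ ∑< n X →
              Σ (ℕ → ℕ → Bool) λ δ → (∀ k → CoversCycleℕ n (δ k)) × (∀ j → ∑[ k < D ] 𝟙 (δ k j) ≤ X j)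
  arcCovers n D X edge total = arc , arc-covers , arc-count
    where
    T = ⌈ n /2⌉ * D
    L U : ℕ → ℕ
    L j = D ∸ X j
    U j = X (succMod n j)

    L≤U : ∀ j → j < n → L j ≤ U j
    L≤U j j<n = m≤n+o⇒m∸n≤o D (X j) (edge j j<n)

    ∑L≤T : ∑< n L ≤ T
    ∑L≤T = +-self-cancel-≤ (begin
      ∑< n L + ∑< n L                     ≡⟨ ∑<-pair L ⟨
      ∑[ j < n ] (L j + L (succMod n j))  ≤⟨ ∑<-mono n (λ j j<n → pair-≤ {X j} (edge j j<n)) ⟩
      ∑[ _ < n ] D                        ≡⟨ ∑<-const n D ⟩
      n * D                               ≤⟨ *-monoˡ-≤ D (n≤⌈n/2⌉+⌈n/2⌉ n) ⟩
      (⌈ n /2⌉ + ⌈ n /2⌉) * D             ≡⟨ *-distribʳ-+ D ⌈ n /2⌉ ⌈ n /2⌉ ⟩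
      T + T                               ∎)
      where
      open ≤-Reasoning
      pair-≤ : ∀ {a b} → D ≤ a + b → (D ∸ a) + (D ∸ b) ≤ D
      pair-≤ {a} {b} D≤a+b = begin
        (D ∸ a) + (D ∸ b)  ≤⟨ +-monoʳ-≤ (D ∸ a) (⊓-glb (m≤n+o⇒m∸n≤o D b (subst (D ≤_) (+-comm a b) D≤a+b)) (m∸n≤m D b)) ⟩
        (D ∸ a) + a ⊓ D    ≡⟨ +-comm (D ∸ a) (a ⊓ D) ⟩
        a ⊓ D + (D ∸ a)    ≡⟨ m⊓n+n∸m≡n a D ⟩
        D                  ∎

    T≤∑U : T ≤ ∑< n U
    T≤∑U = subst (T ≤_) (sym (∑<-rotate X)) total

    interpolation = ∑<-interpolate n L U T L≤U ∑L≤T T≤∑U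
    d : ℕ → ℕ
    d = proj₁ interpolation

    offset : ℕ → ℕ
    offset j = ∑< j d

    arc : ℕ → ℕ → Bool
    arc k j = does ((k + offset j) % D <? X j)

    offset-periodic : ∀ k j → j < n → (k + offset (succMod n j)) % D ≡ (k + offset (suc j)) % D
    offset-periodic k j j<n with m≤n⇒m<n∨m≡n j<n
    ... | inj₁ 1+j<n = cong (λ i → (k + offset i) % D) (succMod-< 1+j<n)
    ... | inj₂ 1+j≡n = begin
      (k + offset (succMod n j)) % D  ≡⟨ cong (λ i → (k + offset i) % D) (succMod-last 1+j≡n) ⟩
      (k + 0) % D                     ≡⟨ %-congˡ (+-identityʳ k) ⟩
      k % D                           ≡⟨ [m+kn]%n≡m%n k ⌈ n /2⌉ D ⟨
      (k + T) % D                     ≡⟨ cong (λ t → (k + t) % D) (proj₂ (proj₂ interpolation)) ⟨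
      (k + offset n) % D              ≡⟨ cong (λ i → (k + offset i) % D) 1+j≡n ⟨
      (k + offset (suc j)) % D        ∎
      where open ≡-Reasoning

    offset-succMod : ∀ k j → j < n → (k + offset (succMod n j)) % D ≡ ((k + offset j) % D + d j) % D
    offset-succMod k j j<n = begin
      (k + offset (succMod n j)) % D   ≡⟨ offset-periodic k j j<n ⟩
      (k + offset (suc j)) % D         ≡⟨ %-congˡ (trans (cong (k +_) (∑<-last j d)) (sym (+-assoc k _ _))) ⟩
      (k + offset j + d j) % D         ≡⟨ [m%d+n]%d≡[m+n]%d (k + offset j) (d j) D ⟨
      ((k + offset j) % D + d j) % D   ∎
      where open ≡-Reasoning

    arc-covers : ∀ k → CoversCycleℕ n (arc k)
    arc-covers k j j<n with (k + offset j) % D <? X j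
    ... | yes u<X = inj₁ (dec-true ((k + offset j) % D <? X j) u<X)
    ... | no  u≮X = inj₂ (dec-true ((k + offset (succMod n j)) % D <? X (succMod n j)) (begin-strict
      (k + offset (succMod n j)) % D   ≡⟨ offset-succMod k j j<n ⟩
      (u + d j) % D                    <⟨ [a+d]%D<d (m%n<n (k + offset j) D) D≤u+d ⟩
      d j                              ≤⟨ proj₂ d-bounds ⟩
      X (succMod n j)                  ∎))
      where
      open ≤-Reasoning
      u = (k + offset j) % D
      d-bounds = proj₁ (proj₂ interpolation) j j<n
      D≤u+d : D ≤ u + d j
      D≤u+d = ≤-trans (m≤n+m∸n D (X j)) (+-mono-≤ (≮⇒≥ u≮X) (proj₁ d-bounds))

    arc-count : ∀ j → ∑[ k < D ] 𝟙 (arc k j) ≤ X j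
    arc-count j = subst (_≤ X j) (sym (count-window D (offset j) (X j))) (m⊓n≤m (X j) D)

open import Defs
open import Data.Nat.Base as ℕ using (ℕ; zero; suc; z≤n; s≤s; ⌈_/2⌉; _%_; NonZero)
import Data.Nat.Properties as ℕₚ
open import Data.Nat.Coprimality as Coprimality using (1-coprimeTo)
open import Data.Integer.Base as ℤ using (1ℤ)
import Data.Integer.Properties as ℤₚ
open import Data.Rational.Base as ℚ using (ℚ; mkℚ; 0ℚ; 1ℚ; _+_; _*_; _≤_; ↥_; ↧ₙ_)
import Data.Rational.Properties as ℚₚ
import Data.Rational.Unnormalised.Base as ℚᵘ
import Data.Rational.Unnormalised.Properties as ℚᵘₚ
open import Data.Bool.Base using (Bool; true; false)
open import Data.List.Base as List using (List; []; _∷_)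
open import Data.List.Relation.Unary.All as All using (All; []; _∷_)
import Data.List.Relation.Unary.All.Properties as All
open import Data.Fin.Base as Fin using (Fin; toℕ; fromℕ<)
import Data.Fin.Properties as Finₚ
open import Data.Product.Base using (Σ; _×_; _,_; proj₁; proj₂)
open import Data.Sum.Base as Sum using (_⊎_; inj₁; inj₂)
open import Data.Empty using (⊥-elim)
open import Function.Base using (_∘_)
open import Function.Bundles using (_⇔_; mk⇔; Equivalence)
open import Relation.Binary.PropositionalEquality
open import Relation.Nullary using (¬_; yes; no)
open import Algebra.Bundles using (CommutativeMonoid)
open import Algebra.Properties.CommutativeSemigroup (CommutativeMonoid.commutativeSemigroup ℚₚ.+-0-commutativeMonoid)
  using (interchange)
open CyclicCovers
  using (∑<; ∑<-const; succMod; succMod-<; succMod-last; 𝟙; CoversCycleℕ; ⌈n/2⌉≤cover; arcCovers;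
         even⇒⌈n/2⌉*c≤∑<; n<⌈n/2⌉+⌈n/2⌉-odd)

-- ℕ→ℚ in normal form, so that its values compute
ι : ℕ → ℚ
ι a = mkℚ (ℤ.+ a) 0 (Coprimality.sym (1-coprimeTo a))

ℕ→ℚ≡ι : ∀ a → ℕ→ℚ a ≡ ι a
ℕ→ℚ≡ι a = ℚₚ.normalize-coprime (Coprimality.sym (1-coprimeTo a))

χ≡ι∘𝟙 : ∀ b → χ b ≡ ι (𝟙 b)
χ≡ι∘𝟙 true  = refl
χ≡ι∘𝟙 false = refl

ι-+ : ∀ a b → ι (a ℕ.+ b) ≡ ι a + ι b
ι-+ a b = ℚₚ.toℚᵘ-injective (ℚᵘₚ.≃-trans (ℚᵘ.*≡* eq) (ℚᵘₚ.≃-sym (ℚₚ.toℚᵘ-homo-+ (ι a) (ι b))))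
  where
  eq : ℤ.+_ (a ℕ.+ b) ℤ.* 1ℤ ≡ (ℤ.+_ a ℤ.* 1ℤ ℤ.+ ℤ.+_ b ℤ.* 1ℤ) ℤ.* 1ℤ
  eq rewrite ℤₚ.*-identityʳ (ℤ.+_ (a ℕ.+ b)) | ℤₚ.*-identityʳ (ℤ.+_ a) | ℤₚ.*-identityʳ (ℤ.+_ b)
           | ℤₚ.*-identityʳ (ℤ.+_ a ℤ.+ ℤ.+_ b) = ℤₚ.pos-+ a b

ι-* : ∀ a b → ι (a ℕ.* b) ≡ ι a * ι b
ι-* a b = ℚₚ.toℚᵘ-injective (ℚᵘₚ.≃-trans (ℚᵘ.*≡* eq) (ℚᵘₚ.≃-sym (ℚₚ.toℚᵘ-homo-* (ι a) (ι b))))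
  where
  eq : ℤ.+_ (a ℕ.* b) ℤ.* 1ℤ ≡ (ℤ.+_ a ℤ.* ℤ.+_ b) ℤ.* 1ℤ
  eq rewrite ℤₚ.*-identityʳ (ℤ.+_ (a ℕ.* b)) | ℤₚ.*-identityʳ (ℤ.+_ a ℤ.* ℤ.+_ b) = ℤₚ.pos-* a b

ι-mono-≤ : ∀ {a b} → a ℕ.≤ b → ι a ≤ ι b
ι-mono-≤ {a} {b} a≤b = ℚ.*≤* (subst₂ ℤ._≤_ (sym (ℤₚ.*-identityʳ (ℤ.+ a))) (sym (ℤₚ.*-identityʳ (ℤ.+ b))) (ℤ.+≤+ a≤b))

ι-cancel-≤ : ∀ {a b} → ι a ≤ ι b → a ℕ.≤ b
ι-cancel-≤ {a} {b} (ℚ.*≤* a≤b) = ℤₚ.drop‿+≤+ (subst₂ ℤ._≤_ (ℤₚ.*-identityʳ (ℤ.+ a)) (ℤₚ.*-identityʳ (ℤ.+ b)) a≤b)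

0≤ι : ∀ a → 0ℚ ≤ ι a
0≤ι a = ι-mono-≤ z≤n

sumL-map : ∀ {A B : Set} (f : B → ℚ) (g : A → B) as → sumL f (List.map g as) ≡ sumL (f ∘ g) as
sumL-map f g []       = refl
sumL-map f g (a ∷ as) = cong (f (g a) +_) (sumL-map f g as)

sumL-cong : ∀ {A : Set} {f g : A → ℚ} as → (∀ a → f a ≡ g a) → sumL f as ≡ sumL g as
sumL-cong []       f≡g = refl
sumL-cong (a ∷ as) f≡g = cong₂ _+_ (f≡g a) (sumL-cong as f≡g)

sumL-mono : ∀ {A : Set} {f g : A → ℚ} {as} → All (λ a → f a ≤ g a) as → sumL f as ≤ sumL g as
sumL-mono []           = ℚₚ.≤-refl
sumL-mono (fa≤ga ∷ f≤g) = ℚₚ.+-mono-≤ fa≤ga (sumL-mono f≤g)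

sumL-zero : ∀ {A : Set} (as : List A) → sumL (λ _ → 0ℚ) as ≡ 0ℚ
sumL-zero []       = refl
sumL-zero (a ∷ as) = trans (ℚₚ.+-identityˡ _) (sumL-zero as)

sumL-distrib-+ : ∀ {A : Set} (f g : A → ℚ) as → sumL (λ a → f a + g a) as ≡ sumL f as + sumL g as
sumL-distrib-+ f g []       = refl
sumL-distrib-+ f g (a ∷ as) =
  trans (cong (f a + g a +_) (sumL-distrib-+ f g as)) (interchange (f a) (g a) (sumL f as) (sumL g as))

*-distribˡ-sumL : ∀ {A : Set} c (f : A → ℚ) as → c * sumL f as ≡ sumL (λ a → c * f a) as
*-distribˡ-sumL c f []       = ℚₚ.*-zeroʳ c
*-distribˡ-sumL c f (a ∷ as) = trans (ℚₚ.*-distribˡ-+ c (f a) _) (cong (c * f a +_) (*-distribˡ-sumL c f as))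

*-distribʳ-sumL : ∀ {A : Set} c (f : A → ℚ) as → sumL f as * c ≡ sumL (λ a → f a * c) as
*-distribʳ-sumL c f []       = ℚₚ.*-zeroˡ c
*-distribʳ-sumL c f (a ∷ as) = trans (ℚₚ.*-distribʳ-+ c (f a) _) (cong (f a * c +_) (*-distribʳ-sumL c f as))

sumL-comm : ∀ {A B : Set} (h : A → B → ℚ) as bs →
            sumL (λ a → sumL (h a) bs) as ≡ sumL (λ b → sumL (λ a → h a b) as) bs
sumL-comm h []       bs = sym (sumL-zero bs)
sumL-comm h (a ∷ as) bs =
  trans (cong (sumL (h a) bs +_) (sumL-comm h as bs)) (sym (sumL-distrib-+ (h a) _ bs))

sumL-allFin : ∀ n {f : Fin n → ℚ} (g : ℕ → ℕ) → (∀ i → f i ≡ ι (g (toℕ i))) →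
              sumL f (allFinL n) ≡ ι (∑< n g)
sumL-allFin zero    g f≡g = refl
sumL-allFin (suc n) {f} g f≡g = begin
  f Fin.zero + sumL f (List.map Fin.suc (allFinL n))  ≡⟨ cong (f Fin.zero +_) (sumL-map f Fin.suc (allFinL n)) ⟩
  f Fin.zero + sumL (f ∘ Fin.suc) (allFinL n)         ≡⟨ cong₂ _+_ (f≡g Fin.zero) (sumL-allFin n (g ∘ suc) (f≡g ∘ Fin.suc)) ⟩
  ι (g 0) + ι (∑< n (g ∘ suc))                        ≡⟨ ι-+ (g 0) _ ⟨
  ι (∑< (suc n) g)                                    ∎
  where open ≡-Reasoning

sumL-allFin-const : ∀ n c → sumL (λ _ → c) (allFinL n) ≡ c * ι n
sumL-allFin-const n c = begin
  sumL (λ _ → c) (allFinL n)         ≡⟨ sumL-cong (allFinL n) (λ _ → ℚₚ.*-identityʳ c) ⟨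
  sumL (λ _ → c * ι 1) (allFinL n)   ≡⟨ *-distribˡ-sumL c (λ _ → ι 1) (allFinL n) ⟨
  c * sumL (λ _ → ι 1) (allFinL n)   ≡⟨ cong (c *_) (sumL-allFin n (λ _ → 1) (λ _ → refl)) ⟩
  c * ι (∑< n (λ _ → 1))             ≡⟨ cong (λ k → c * ι k) (trans (∑<-const n 1) (ℕₚ.*-identityʳ n)) ⟩
  c * ι n                            ∎
  where open ≡-Reasoning

allFin⁺ : ∀ n {P : Fin n → Set} → (∀ i → P i) → All P (allFinL n)
allFin⁺ zero    p = []
allFin⁺ (suc n) p = p Fin.zero ∷ All.map⁺ (allFin⁺ n (p ∘ Fin.suc))

allFin⁻ : ∀ n {P : Fin n → Set} → All P (allFinL n) → ∀ i → P i
allFin⁻ (suc n) (p₀ ∷ ps) Fin.zero    = p₀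
allFin⁻ (suc n) (p₀ ∷ ps) (Fin.suc i) = allFin⁻ n (All.map⁻ ps) i

CoversCycle : ∀ n → (Fin n → Bool) → Set
CoversCycle n δ = ∀ i → δ i ≡ true ⊎ δ (next i) ≡ true

module _ {n : ℕ} (δ : Fin n → Bool) where

  -- the vertices of Star n − δ that lie in the component of the centre
  Attached : Fin (suc n) → Set
  Attached v = v ≡ Fin.zero ⊎ Σ (Fin n) λ i → v ≡ Fin.suc i × δ i ≡ false

  reach-star : ∀ {u w} → Reach (Star n) δ u w → u ≡ w ⊎ (Attached u × Attached w)
  reach-star here = inj₁ refl
  reach-star (fwd i δi≡false refl r) with reach-star r
  ... | inj₁ refl          = inj₂ (inj₁ refl , inj₂ (i , refl , δi≡false))
  ... | inj₂ (_ , attached) = inj₂ (inj₁ refl , attached)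
  reach-star (bwd i δi≡false refl r) with reach-star r
  ... | inj₁ refl          = inj₂ (inj₂ (i , refl , δi≡false) , inj₁ refl)
  ... | inj₂ (_ , attached) = inj₂ (inj₂ (i , refl , δi≡false) , attached)

  attached-leaf : ∀ {i} → Attached (Fin.suc i) → δ i ≡ false
  attached-leaf (inj₂ (_ , refl , δi≡false)) = δi≡false

toℕ-next : ∀ {m} (i : Fin (suc m)) → toℕ (next i) ≡ succMod (suc m) (toℕ i)
toℕ-next i = Finₚ.toℕ-fromℕ< _

next≢id : ∀ {m} (i : Fin (suc (suc m))) → next i ≢ i
next≢id {m} i next≡i with ℕₚ.m≤n⇒m<n∨m≡n (Finₚ.toℕ<n i)
... | inj₁ 1+i<n = ℕₚ.1+n≢n (trans (sym (succMod-< 1+i<n)) succMod≡i)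
  where
  succMod≡i : succMod (suc (suc m)) (toℕ i) ≡ toℕ i
  succMod≡i = trans (sym (toℕ-next i)) (cong toℕ next≡i)
... | inj₂ 1+i≡n = ℕₚ.0≢1+n (ℕₚ.suc-injective (trans (cong suc i≡0) 1+i≡n))
  where
  i≡0 : 0 ≡ toℕ i
  i≡0 = trans (sym (succMod-last 1+i≡n)) (trans (sym (toℕ-next i)) (cong toℕ next≡i))

multicut⇒covers : ∀ n {δ} → IsMulticut (Star n) (cycleTerminals n) δ → CoversCycle n δ
multicut⇒covers n {δ} multicut i with δ i in δi | δ (next i) in δi+1
... | true  | _     = inj₁ refl
... | false | true  = inj₂ refl
... | false | false = ⊥-elim (allFin⁻ n (All.map⁻ multicut) i (bwd i δi refl (fwd (next i) δi+1 refl here)))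

covers⇒multicut : ∀ m {δ} → CoversCycle (suc (suc m)) δ →
                  IsMulticut (Star (suc (suc m))) (cycleTerminals (suc (suc m))) δ
covers⇒multicut m {δ} covers = All.map⁺ (allFin⁺ _ separated)
  where
  separated : ∀ i → ¬ Reach (Star (suc (suc m))) δ (Fin.suc i) (Fin.suc (next i))
  separated i r with reach-star δ r | covers i
  ... | inj₁ leaves≡ | _ = next≢id i (sym (Finₚ.suc-injective leaves≡))
  ... | inj₂ (attached , _) | inj₁ δi≡true with () ← trans (sym δi≡true) (attached-leaf δ attached)
  ... | inj₂ (_ , attached) | inj₂ δi+1≡true with () ← trans (sym δi+1≡true) (attached-leaf δ attached)

extend : ∀ {B : Set} n → B → (Fin n → B) → ℕ → B
extend n b f j with j ℕₚ.<? n
... | yes j<n = f (fromℕ< j<n)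
... | no  _   = b

extend-toℕ : ∀ {B : Set} n (b : B) f (i : Fin n) → extend n b f (toℕ i) ≡ f i
extend-toℕ n b f i with toℕ i ℕₚ.<? n
... | yes i<n = cong f (Finₚ.fromℕ<-toℕ i i<n)
... | no  i≮n = ⊥-elim (i≮n (Finₚ.toℕ<n i))

extend-next : ∀ {B : Set} m (b : B) f (i : Fin (suc m)) → extend (suc m) b f (succMod (suc m) (toℕ i)) ≡ f (next i)
extend-next m b f i = trans (cong (extend (suc m) b f) (sym (toℕ-next i))) (extend-toℕ (suc m) b f (next i))

∀Fin⇒∀< : ∀ {n} {P : ℕ → Set} → (∀ (i : Fin n) → P (toℕ i)) → ∀ j → j ℕ.< n → P j
∀Fin⇒∀< {P = P} p j j<n = subst P (Finₚ.toℕ-fromℕ< j<n) (p (fromℕ< j<n))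

covers⇒coversℕ : ∀ m {δ} → CoversCycle (suc m) δ → CoversCycleℕ (suc m) (extend (suc m) false δ)
covers⇒coversℕ m {δ} covers = ∀Fin⇒∀< λ i →
  Sum.map (trans (extend-toℕ (suc m) false δ i)) (trans (extend-next m false δ i)) (covers i)

coversℕ⇒covers : ∀ m {δ} → CoversCycleℕ (suc m) δ → CoversCycle (suc m) (δ ∘ toℕ)
coversℕ⇒covers m {δ} covers i with covers (toℕ i) (Finₚ.toℕ<n i)
... | inj₁ δi≡true   = inj₁ δi≡true
... | inj₂ δi+1≡true = inj₂ (trans (cong δ (toℕ-next i)) δi+1≡true)

-- The right-hand side is linear and monotone in x, so validity passes from the multicuts to the dominant.
dominant-valid : ∀ {G S} (es : List (E G)) β →
                 (∀ δ → IsMulticut G S δ → β ≤ sumL (χ ∘ δ) es) →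
                 ∀ x → InMultC G S x → β ≤ sumL x es
dominant-valid {G} {S} es β valid x (comb , admissible , ∑w≡1 , dominated) = begin
  β                                                   ≡⟨ ℚₚ.*-identityˡ β ⟨
  1ℚ * β                                              ≡⟨ cong (_* β) ∑w≡1 ⟨
  sumL weight comb * β                                ≡⟨ *-distribʳ-sumL β weight comb ⟩
  sumL (λ p → weight p * β) comb                      ≤⟨ sumL-mono (All.map bound admissible) ⟩
  sumL (λ p → weight p * sumL (χ ∘ cut p) es) comb    ≡⟨ sumL-cong comb (λ p → *-distribˡ-sumL (weight p) (χ ∘ cut p) es) ⟩
  sumL (λ p → sumL (λ e → weight p * χ (cut p e)) es) comb
    ≡⟨ sumL-comm (λ p e → weight p * χ (cut p e)) comb es ⟩
  sumL (λ e → sumL (λ p → weight p * χ (cut p e)) comb) es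
    ≤⟨ sumL-mono (All.universal dominated es) ⟩
  sumL x es                                           ∎
  where
  open ℚₚ.≤-Reasoning
  weight : ℚ × EdgeSet G → ℚ
  weight = proj₁
  cut : ℚ × EdgeSet G → EdgeSet G
  cut = proj₂
  bound : ∀ {p} → (0ℚ ≤ weight p) × IsMulticut G S (cut p) → weight p * β ≤ weight p * sumL (χ ∘ cut p) es
  bound {p} (0≤w , multicut) = ℚₚ.*-monoˡ-≤-nonNeg (weight p) {{ℚ.nonNegative 0≤w}} (valid (cut p) multicut)

χ-nonNeg : ∀ b → 0ℚ ≤ χ b + 0ℚ
χ-nonNeg true  = ℚ.*≤* (ℤ.+≤+ z≤n)
χ-nonNeg false = ℚₚ.≤-refl

χ-one-of : ∀ {a b} → a ≡ true ⊎ b ≡ true → 1ℚ ≤ χ a + (χ b + 0ℚ)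
χ-one-of {true}  {true}  _ = ℚ.*≤* (ℤ.+≤+ (s≤s z≤n))
χ-one-of {true}  {false} _ = ℚₚ.≤-refl
χ-one-of {false} {true}  _ = ℚₚ.≤-refl
χ-one-of {false} {false} (inj₁ ())
χ-one-of {false} {false} (inj₂ ())

multicut-size : ∀ m {δ} → IsMulticut (Star (suc m)) (cycleTerminals (suc m)) δ →
                ℕ→ℚ ⌈ suc m /2⌉ ≤ sumL (χ ∘ δ) (allFinL (suc m))
multicut-size m {δ} multicut = subst₂ _≤_ (sym (ℕ→ℚ≡ι _)) (sym ∑χ≡ι∑𝟙)
  (ι-mono-≤ (⌈n/2⌉≤cover (covers⇒coversℕ m (multicut⇒covers (suc m) multicut))))
  where
  ∑χ≡ι∑𝟙 : sumL (χ ∘ δ) (allFinL (suc m)) ≡ ι (∑< (suc m) (𝟙 ∘ extend (suc m) false δ))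
  ∑χ≡ι∑𝟙 = sumL-allFin (suc m) (𝟙 ∘ extend (suc m) false δ)
    (λ i → trans (χ≡ι∘𝟙 (δ i)) (cong (ι ∘ 𝟙) (sym (extend-toℕ (suc m) false δ i))))

sound : ∀ m x → InMultC (Star (suc m)) (cycleTerminals (suc m)) x →
        Nonneg (suc m) x × EdgeIneqs (suc m) x × SumIneq (suc m) x
sound m x x∈MultC = nonneg , edges , total
  where
  nonneg : Nonneg (suc m) x
  nonneg e = subst (0ℚ ≤_) (ℚₚ.+-identityʳ (x e))
    (dominant-valid (e ∷ []) 0ℚ (λ δ _ → χ-nonNeg (δ e)) x x∈MultC)
  edges : EdgeIneqs (suc m) x
  edges i = subst (1ℚ ≤_) (cong (x i +_) (ℚₚ.+-identityʳ (x (next i))))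
    (dominant-valid (i ∷ next i ∷ []) 1ℚ (λ δ multicut → χ-one-of (multicut⇒covers (suc m) multicut i)) x x∈MultC)
  total : SumIneq (suc m) x
  total = dominant-valid (allFinL (suc m)) _ (λ δ → multicut-size m) x x∈MultC

0≤1/ι : ∀ D .{{_ : NonZero D}} → 0ℚ ≤ ℚ.1/ ι D
0≤1/ι (suc d) = ℚₚ.nonNegative⁻¹ _

average-of-multicuts : ∀ {G S} D .{{_ : NonZero D}} (cuts : Fin D → EdgeSet G) → (∀ k → IsMulticut G S (cuts k)) →
                       ∀ x → (∀ e → sumL (λ k → χ (cuts k e)) (allFinL D) ≤ ι D * x e) → InMultC G S x
average-of-multicuts {G} {S} D cuts multicuts x bounded = comb , admissible , ∑w≡1 , dominated
  where
  w : ℚ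
  w = ℚ.1/ ι D
  w*D≡1 : w * ι D ≡ 1ℚ
  w*D≡1 = ℚₚ.*-inverseˡ (ι D)
  0≤w : 0ℚ ≤ w
  0≤w = 0≤1/ι D
  comb : List (ℚ × EdgeSet G)
  comb = List.map (λ k → w , cuts k) (allFinL D)
  admissible : All (λ p → (0ℚ ≤ proj₁ p) × IsMulticut G S (proj₂ p)) comb
  admissible = All.map⁺ (allFin⁺ D (λ k → 0≤w , multicuts k))
  ∑w≡1 : sumL proj₁ comb ≡ 1ℚ
  ∑w≡1 = trans (sumL-map proj₁ _ (allFinL D)) (trans (sumL-allFin-const D w) w*D≡1)
  dominated : ∀ e → sumL (λ p → proj₁ p * χ (proj₂ p e)) comb ≤ x e
  dominated e = begin
    sumL (λ p → proj₁ p * χ (proj₂ p e)) comb   ≡⟨ sumL-map (λ p → proj₁ p * χ (proj₂ p e)) _ (allFinL D) ⟩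
    sumL (λ k → w * χ (cuts k e)) (allFinL D)  ≡⟨ *-distribˡ-sumL w (λ k → χ (cuts k e)) (allFinL D) ⟨
    w * sumL (λ k → χ (cuts k e)) (allFinL D)  ≤⟨ ℚₚ.*-monoˡ-≤-nonNeg w {{ℚ.nonNegative 0≤w}} (bounded e) ⟩
    w * (ι D * x e)                            ≡⟨ ℚₚ.*-assoc w (ι D) (x e) ⟨
    w * ι D * x e                              ≡⟨ cong (_* x e) w*D≡1 ⟩
    1ℚ * x e                                   ≡⟨ ℚₚ.*-identityˡ (x e) ⟩
    x e                                        ∎
    where open ℚₚ.≤-Reasoning

ι-clear-denominator : ∀ p q → 0ℚ ≤ p → ι (ℤ.∣ ↥ p ∣ ℕ.* q) ≡ ι (q ℕ.* ↧ₙ p) * p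
ι-clear-denominator p@(mkℚ (ℤ.+_ a) d _) q _ =
  ℚₚ.toℚᵘ-injective (ℚᵘₚ.≃-trans (ℚᵘ.*≡* eq) (ℚᵘₚ.≃-sym (ℚₚ.toℚᵘ-homo-* (ι (q ℕ.* suc d)) p)))
  where
  eq : ℤ.+_ (a ℕ.* q) ℤ.* ℤ.+_ (suc (d ℕ.+ 0)) ≡ (ℤ.+_ (q ℕ.* suc d) ℤ.* ℤ.+_ a) ℤ.* 1ℤ
  eq rewrite ℕₚ.+-identityʳ d | ℤₚ.*-identityʳ (ℤ.+_ (q ℕ.* suc d) ℤ.* ℤ.+_ a) =
    trans (sym (ℤₚ.pos-* (a ℕ.* q) (suc d)))
          (trans (cong ℤ.+_ (trans (ℕₚ.*-assoc a q (suc d)) (ℕₚ.*-comm a (q ℕ.* suc d))))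
                 (ℤₚ.pos-* (q ℕ.* suc d) a))
ι-clear-denominator (mkℚ ℤ.-[1+ _ ] _ _) q (ℚ.*≤* ())

denominatorProduct : ∀ n → (Fin n → ℚ) → ℕ
denominatorProduct zero    x = 1
denominatorProduct (suc n) x = ↧ₙ x Fin.zero ℕ.* denominatorProduct n (x ∘ Fin.suc)

denominatorProduct-nonZero : ∀ n x → NonZero (denominatorProduct n x)
denominatorProduct-nonZero zero    x = _
denominatorProduct-nonZero (suc n) x =
  ℕₚ.m*n≢0 (↧ₙ x Fin.zero) _ {{_}} {{denominatorProduct-nonZero n (x ∘ Fin.suc)}}

cofactor : ∀ n (x : Fin n → ℚ) → Fin n → ℕ
cofactor (suc n) x Fin.zero    = denominatorProduct n (x ∘ Fin.suc)
cofactor (suc n) x (Fin.suc i) = ↧ₙ x Fin.zero ℕ.* cofactor n (x ∘ Fin.suc) i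

cofactor*↧≡denominatorProduct : ∀ n x i → cofactor n x i ℕ.* ↧ₙ x i ≡ denominatorProduct n x
cofactor*↧≡denominatorProduct (suc n) x Fin.zero    = ℕₚ.*-comm _ (↧ₙ x Fin.zero)
cofactor*↧≡denominatorProduct (suc n) x (Fin.suc i) =
  trans (ℕₚ.*-assoc (↧ₙ x Fin.zero) (cofactor n (x ∘ Fin.suc) i) (↧ₙ x (Fin.suc i)))
        (cong (↧ₙ x Fin.zero ℕ.*_) (cofactor*↧≡denominatorProduct n (x ∘ Fin.suc) i))

ι-positive : ∀ D .{{_ : NonZero D}} → ℚ.Positive (ι D)
ι-positive (suc _) = _

-- X is D·x as a vector of naturals, indexed by ℕ (padded with 0) for the arc construction
module Scaled (m : ℕ) (x : Fin (suc m) → ℚ) (nonneg : Nonneg (suc m) x) where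

  D : ℕ
  D = denominatorProduct (suc m) x

  instance
    D≢0 : NonZero D
    D≢0 = denominatorProduct-nonZero (suc m) x

  X : ℕ → ℕ
  X = extend (suc m) 0 (λ i → ℤ.∣ ↥ x i ∣ ℕ.* cofactor (suc m) x i)

  ι-X : ∀ i → ι (X (toℕ i)) ≡ ι D * x i
  ι-X i = begin
    ι (X (toℕ i))                              ≡⟨ cong ι (extend-toℕ (suc m) 0 _ i) ⟩
    ι (ℤ.∣ ↥ x i ∣ ℕ.* cofactor (suc m) x i)    ≡⟨ ι-clear-denominator (x i) _ (nonneg i) ⟩
    ι (cofactor (suc m) x i ℕ.* ↧ₙ x i) * x i  ≡⟨ cong (λ k → ι k * x i) (cofactor*↧≡denominatorProduct (suc m) x i) ⟩
    ι D * x i                                  ∎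
    where open ≡-Reasoning

  ι-∑X : ι (∑< (suc m) X) ≡ sumL x (allFinL (suc m)) * ι D
  ι-∑X = begin
    ι (∑< (suc m) X)                              ≡⟨ sumL-allFin (suc m) X (λ i → refl) ⟨
    sumL (λ i → ι (X (toℕ i))) (allFinL (suc m))  ≡⟨ sumL-cong (allFinL (suc m)) (λ i → trans (ι-X i) (ℚₚ.*-comm (ι D) (x i))) ⟩
    sumL (λ i → x i * ι D) (allFinL (suc m))      ≡⟨ *-distribʳ-sumL (ι D) x (allFinL (suc m)) ⟨
    sumL x (allFinL (suc m)) * ι D                ∎
    where open ≡-Reasoning

  scaled-edges : EdgeIneqs (suc m) x → ∀ j → j ℕ.< suc m → D ℕ.≤ X j ℕ.+ X (succMod (suc m) j)
  scaled-edges edges = ∀Fin⇒∀< (λ i → ι-cancel-≤ (begin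
    ι D                                              ≡⟨ ℚₚ.*-identityʳ (ι D) ⟨
    ι D * 1ℚ                                         ≤⟨ ℚₚ.*-monoˡ-≤-nonNeg (ι D) {{ℚ.nonNegative (0≤ι D)}} (edges i) ⟩
    ι D * (x i + x (next i))                         ≡⟨ ℚₚ.*-distribˡ-+ (ι D) (x i) (x (next i)) ⟩
    ι D * x i + ι D * x (next i)                     ≡⟨ cong₂ _+_ (ι-X i) (trans (cong (ι ∘ X) (sym (toℕ-next i))) (ι-X (next i))) ⟨
    ι (X (toℕ i)) + ι (X (succMod (suc m) (toℕ i)))  ≡⟨ ι-+ (X (toℕ i)) (X (succMod (suc m) (toℕ i))) ⟨
    ι (X (toℕ i) ℕ.+ X (succMod (suc m) (toℕ i)))    ∎))
    where open ℚₚ.≤-Reasoning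

  sumIneq⇔ : SumIneq (suc m) x ⇔ ⌈ suc m /2⌉ ℕ.* D ℕ.≤ ∑< (suc m) X
  sumIneq⇔ = mk⇔ to from
    where
    to : SumIneq (suc m) x → ⌈ suc m /2⌉ ℕ.* D ℕ.≤ ∑< (suc m) X
    to total = ι-cancel-≤ (begin
      ι (⌈ suc m /2⌉ ℕ.* D)           ≡⟨ ι-* ⌈ suc m /2⌉ D ⟩
      ι ⌈ suc m /2⌉ * ι D             ≤⟨ ℚₚ.*-monoʳ-≤-nonNeg (ι D) {{ℚ.nonNegative (0≤ι D)}}
                                           (subst (_≤ sumL x (allFinL (suc m))) (ℕ→ℚ≡ι ⌈ suc m /2⌉) total) ⟩
      sumL x (allFinL (suc m)) * ι D  ≡⟨ ι-∑X ⟨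
      ι (∑< (suc m) X)                ∎)
      where open ℚₚ.≤-Reasoning
    from : ⌈ suc m /2⌉ ℕ.* D ℕ.≤ ∑< (suc m) X → SumIneq (suc m) x
    from total = subst (_≤ sumL x (allFinL (suc m))) (sym (ℕ→ℚ≡ι ⌈ suc m /2⌉))
      (ℚₚ.*-cancelʳ-≤-pos (ι D) {{ι-positive D}} (begin
      ι ⌈ suc m /2⌉ * ι D             ≡⟨ ι-* ⌈ suc m /2⌉ D ⟨
      ι (⌈ suc m /2⌉ ℕ.* D)           ≤⟨ ι-mono-≤ total ⟩
      ι (∑< (suc m) X)                ≡⟨ ι-∑X ⟩
      sumL x (allFinL (suc m)) * ι D  ∎))
      where open ℚₚ.≤-Reasoning

complete : ∀ m x → Nonneg (suc (suc m)) x → EdgeIneqs (suc (suc m)) x → SumIneq (suc (suc m)) x →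
           InMultC (Star (suc (suc m))) (cycleTerminals (suc (suc m))) x
complete m x nonneg edges total = average-of-multicuts D (λ k → arc (toℕ k) ∘ toℕ) multicuts x bounded
  where
  open Scaled (suc m) x nonneg
  arcs = arcCovers (suc (suc m)) D X (scaled-edges edges) (Equivalence.to sumIneq⇔ total)
  arc : ℕ → ℕ → Bool
  arc = proj₁ arcs
  multicuts : ∀ k → IsMulticut (Star (suc (suc m))) (cycleTerminals (suc (suc m))) (arc (toℕ k) ∘ toℕ)
  multicuts k = covers⇒multicut m (coversℕ⇒covers (suc m) (proj₁ (proj₂ arcs) (toℕ k)))
  bounded : ∀ e → sumL (λ k → χ (arc (toℕ k) (toℕ e))) (allFinL D) ≤ ι D * x e
  bounded e = begin
    sumL (λ k → χ (arc (toℕ k) (toℕ e))) (allFinL D)  ≡⟨ sumL-allFin D (λ k → 𝟙 (arc k (toℕ e))) (λ k → χ≡ι∘𝟙 _) ⟩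
    ι (∑< D (λ k → 𝟙 (arc k (toℕ e))))                 ≤⟨ ι-mono-≤ (proj₂ (proj₂ arcs) (toℕ e)) ⟩
    ι (X (toℕ e))                                      ≡⟨ ι-X e ⟩
    ι D * x e                                          ∎
    where open ℚₚ.≤-Reasoning

even⇒sumIneq : ∀ m x → Nonneg (suc m) x → suc m % 2 ≡ 0 → EdgeIneqs (suc m) x → SumIneq (suc m) x
even⇒sumIneq m x nonneg even edges =
  Equivalence.from sumIneq⇔ (even⇒⌈n/2⌉*c≤∑< X even (scaled-edges edges))
  where open Scaled m x nonneg

½-violates-sumIneq : ∀ n → n % 2 ≢ 0 → ¬ SumIneq n (λ _ → ℚ.½)
½-violates-sumIneq n odd total = ℕₚ.<⇒≱ (n<⌈n/2⌉+⌈n/2⌉-odd n odd) (ι-cancel-≤ (begin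
  ι (⌈ n /2⌉ ℕ.+ ⌈ n /2⌉)     ≡⟨ cong ι (cong (⌈ n /2⌉ ℕ.+_) (ℕₚ.+-identityʳ ⌈ n /2⌉)) ⟨
  ι (2 ℕ.* ⌈ n /2⌉)           ≡⟨ ι-* 2 ⌈ n /2⌉ ⟩
  ι 2 * ι ⌈ n /2⌉             ≤⟨ ℚₚ.*-monoˡ-≤-nonNeg (ι 2) (subst₂ _≤_ (ℕ→ℚ≡ι ⌈ n /2⌉) (sumL-allFin-const n ℚ.½) total) ⟩
  ι 2 * (ℚ.½ * ι n)           ≡⟨ ℚₚ.*-assoc (ι 2) ℚ.½ (ι n) ⟨
  ι 2 * ℚ.½ * ι n             ≡⟨ ℚₚ.*-identityˡ (ι n) ⟩
  ι n                         ∎))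
  where open ℚₚ.≤-Reasoning

corollary5p2 : (n : ℕ) → 3 ℕ.≤ n →
    ((x : Fin n → ℚ) →
      InMultC (Star n) (cycleTerminals n) x ⇔ (Nonneg n x × EdgeIneqs n x × SumIneq n x))
    × ((n % 2 ≡ 0) ⇔
      ((x : Fin n → ℚ) →
        InMultC (Star n) (cycleTerminals n) x ⇔ (Nonneg n x × EdgeIneqs n x)))
corollary5p2 (suc zero)          (s≤s ())
corollary5p2 (suc (suc zero))    (s≤s (s≤s ()))
corollary5p2 (suc (suc (suc k))) _ = characterisation , mk⇔ even⇒characterisation characterisation⇒even
  where
  m = suc k
  n = suc (suc m)
  characterisation : ∀ x → InMultC (Star n) (cycleTerminals n) x ⇔ (Nonneg n x × EdgeIneqs n x × SumIneq n x)
  characterisation x = mk⇔ (sound (suc m) x) λ (nonneg , edges , total) → complete m x nonneg edges total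
  even⇒characterisation : n % 2 ≡ 0 → ∀ x → InMultC (Star n) (cycleTerminals n) x ⇔ (Nonneg n x × EdgeIneqs n x)
  even⇒characterisation even x = mk⇔
    (λ x∈MultC → let (nonneg , edges , _) = sound (suc m) x x∈MultC in nonneg , edges)
    (λ (nonneg , edges) → complete m x nonneg edges (even⇒sumIneq (suc m) x nonneg even edges))
  characterisation⇒even : (∀ x → InMultC (Star n) (cycleTerminals n) x ⇔ (Nonneg n x × EdgeIneqs n x)) → n % 2 ≡ 0
  characterisation⇒even char with n % 2 ℕₚ.≟ 0
  ... | yes even = even
  ... | no  odd  = ⊥-elim (½-violates-sumIneq n odd (proj₂ (proj₂ (sound (suc m) half half∈MultC))))
    where
    half : Fin n → ℚ
    half _ = ℚ.½
    half∈MultC : InMultC (Star n) (cycleTerminals n) half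
    half∈MultC = Equivalence.from (char half) ((λ _ → ℚ.*≤* (ℤ.+≤+ z≤n)) , λ _ → ℚₚ.≤-refl)
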